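{- Let $(G,T)$ be a graft such that $G$ has no isolated vertices. Then there exists $X\subseteq E(G)$ such that the delta-matroid $\mathcal{G}(G,T)\triangle X$ is isomorphic to $MK_3$ if and only if $(G,T)$ is isomorphic to one of $\Delta_1$, $\Delta_2$, $\Delta_3$.
   Context: Graphs are finite and may have loops and parallel edges. A delta-matroid is a pair $(V,\mathcal{F})$ of a finite set $V$ and a nonempty family $\mathcal{F}$ of subsets of $V$ (feasible sets) such that if $X,Y\in\mathcal{F}$ and $x\in X\triangle Y$ then there is $y\in X\triangle Y$ with $X\triangle\{x,y\}\in\mathcal{F}$. For $X\subseteq V$, the twist is $(V,\mathcal{F})\triangle X=(V,\{F\triangle X:F\in\mathcal{F}\})$. A graft is a pair $(G,T)$ of a graph $G$ and a subset $T\subseteq V(G)$. A subgraph $H$ of $G$ is $T$-spanning if $V(H)=V(G)$ and every component $C$ of $H$ satisfies either (i) $|V(C)\cap T|$ is odd, or (ii) $V(C)\cap T=\emptyset$ and $G[V(C)]$ is a component of $G$. A set $F\subseteq E(G)$ is feasible in $(G,T)$ if it is the edge set of a $T$-spanning forest of $G$, and $\mathcal{G}(G,T)=(E(G),\mathcal{F})$ where $\mathcal{F}$ is the set of feasible sets. Two grafts $(G,T)$, $(G',T')$ are isomorphic if there is a graph isomorphism $G\to G'$ mapping $T$ onto $T'$. Let $MK_3=(\{1,2,3\},\{\emptyset,\{1,2\},\{1,3\},\{2,3\}\})$, $\Delta_1=(K_3,V(K_3))$, $\Delta_2=(K_{1,3},V(K_{1,3}))$, and $\Delta_3=(K_{1,3},S)$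 where $S$ is the set of the three degree-$1$ vertices of $K_{1,3}$. -}

module Defs where

open import Data.Nat using (ℕ; _%_)
open import Data.Fin using (Fin; zero; suc)
open import Data.Bool using (Bool; _xor_)
open import Data.Vec using (Vec; zipWith; tabulate; lookup; _∷_; [])
open import Data.Fin.Subset as S using (Subset; _∈_; _∉_; _∩_; _-_; ∣_∣; inside; outside)
open import Data.Product using (Σ; ∃; _×_; _,_; proj₁; proj₂)
open import Data.Sum using (_⊎_)
open import Relation.Nullary using (¬_)
open import Relation.Binary.PropositionalEquality using (_≡_)
open import Function.Bundles using (_↔_; _⇔_; Inverse)

-- Finite graphs with loops and parallel edges.
-- Vertices are Fin nV, edges are Fin nE, each edge has a pair of ends
-- (read as an unordered pair; a loop has equal ends).

record Graph : Set where
  field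
    nV   : ℕ
    nE   : ℕ
    ends : Fin nE → Fin nV × Fin nV
open Graph public

Joins : (G : Graph) → Fin (nE G) → Fin (nV G) → Fin (nV G) → Set
Joins G e u w = (ends G e ≡ (u , w)) ⊎ (ends G e ≡ (w , u))

NoIsolated : Graph → Set
NoIsolated G = (v : Fin (nV G)) → ∃ λ e → ∃ λ w → Joins G e v w

data Reach (G : Graph) (F : Subset (nE G)) : Fin (nV G) → Fin (nV G) → Set where
  here : ∀ {v} → Reach G F v v
  step : ∀ {u w x} (e : Fin (nE G)) → e ∈ F → Joins G e u w →
         Reach G F w x → Reach G F u x

-- (V(G), F) is a forest: no edge of F lies on a cycle of F, i.e. the ends
-- of every e ∈ F are disconnected in F - e (this excludes loops too).
Forest : (G : Graph) → Subset (nE G) → Set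
Forest G F = (e : Fin (nE G)) → e ∈ F →
  ¬ Reach G (F - e) (proj₁ (ends G e)) (proj₂ (ends G e))

AllE : (G : Graph) → Subset (nE G)
AllE G = S.⊤

-- The component C of (V(G),F) containing v satisfies:
--  (i) |V(C) ∩ T| is odd, or
--  (ii) V(C) ∩ T = ∅ and G[V(C)] is a component of G.
ComponentOK : (G : Graph) (T : Subset (nV G)) (F : Subset (nE G)) → Fin (nV G) → Set
ComponentOK G T F v =
  (Σ (Subset (nV G)) λ C →
      ((u : Fin (nV G)) → (u ∈ C → Reach G F v u) × (Reach G F v u → u ∈ C))
    × (∣ C ∩ T ∣ % 2 ≡ 1))
  ⊎ (((u : Fin (nV G)) → Reach G F v u → u ∉ T)
    × ((u : Fin (nV G)) → Reach G (AllE G) v u → Reach G F v u))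

TSpanning : (G : Graph) (T : Subset (nV G)) → Subset (nE G) → Set
TSpanning G T F = (v : Fin (nV G)) → ComponentOK G T F v

record SetSystem : Set₁ where
  field
    size     : ℕ
    Feasible : Subset size → Set
open SetSystem public

_△_ : ∀ {n} → Subset n → Subset n → Subset n
_△_ = zipWith _xor_

twist : (D : SetSystem) → Subset (size D) → SetSystem
twist D X = record { size = size D ; Feasible = λ F → Feasible D (F △ X) }

image : ∀ {n m} → (Fin n ↔ Fin m) → Subset n → Subset m
image π F = tabulate λ j → lookup F (Inverse.from π j)

_≅_ : SetSystem → SetSystem → Set
D ≅ D' = Σ (Fin (size D) ↔ Fin (size D')) λ π →
  (F : Subset (size D)) → Feasible D F ⇔ Feasible D' (image π F)

graftDM : (G : Graph) → Subset (nV G) → SetSystem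
graftDM G T = record
  { size = nE G
  ; Feasible = λ F → Forest G F × TSpanning G T F }

MK3 : SetSystem
MK3 = record
  { size = 3
  ; Feasible = λ F →
      (F ≡ outside ∷ outside ∷ outside ∷ [])
    ⊎ (F ≡ inside ∷ inside ∷ outside ∷ [])
    ⊎ (F ≡ inside ∷ outside ∷ inside ∷ [])
    ⊎ (F ≡ outside ∷ inside ∷ inside ∷ []) }

GraftIso : (G : Graph) → Subset (nV G) → (G' : Graph) → Subset (nV G') → Set
GraftIso G T G' T' =
  Σ (Fin (nV G) ↔ Fin (nV G')) λ φ → Σ (Fin (nE G) ↔ Fin (nE G')) λ ψ →
    ((e : Fin (nE G)) →
       Joins G' (Inverse.to ψ e) (Inverse.to φ (proj₁ (ends G e)))
                                 (Inverse.to φ (proj₂ (ends G e))))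
  × ((v : Fin (nV G)) → (v ∈ T → Inverse.to φ v ∈ T') × (Inverse.to φ v ∈ T' → v ∈ T))

K3 : Graph
K3 = record { nV = 3 ; nE = 3 ; ends = f }
  where
  f : Fin 3 → Fin 3 × Fin 3
  f zero = (zero , suc zero)
  f (suc zero) = (suc zero , suc (suc zero))
  f (suc (suc zero)) = (zero , suc (suc zero))

K13 : Graph
K13 = record { nV = 4 ; nE = 3 ; ends = λ i → (zero , suc i) }

leavesK13 : Subset 4
leavesK13 = outside ∷ inside ∷ inside ∷ inside ∷ []

-- (G,T) is isomorphic to one of Δ₁ = (K₃, V), Δ₂ = (K₁,₃, V), Δ₃ = (K₁,₃, leaves)
IsDelta : (G : Graph) → Subset (nV G) → Set
IsDelta G T = GraftIso G T K3 S.⊤ ⊎ GraftIso G T K13 S.⊤ ⊎ GraftIso G T K13 leavesK13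

module Submission where

-- MK₃ is the family of even subsets of a 3-set; a twist by X shifts parities by that of X,
-- and a bijection of ground sets preserves them. So some twist of 𝒢(G,T) is isomorphic to
-- MK₃ exactly when G has three edges and the feasible sets of 𝒢(G,T) are the edge sets of
-- one fixed parity.
-- Even parity: ∅ is feasible, and a vertex that is a component of the empty forest but not
-- of G must lie in T, so T = V(G). Every pair of edges is a forest, so the edges are simple
-- links, and two edges cannot form a component of their own, which would contain two
-- vertices of T; three pairwise meeting simple links form K₃ or K₁,₃.
-- Odd parity: ∅ is infeasible, so some vertex o lies outside T. By the same argument a
-- singleton {e} must touch o, so G is a star at o, and a singleton at another edge puts
-- every leaf in T.
-- Conversely Δ₁, Δ₂ (even) and Δ₃ (odd) carry parity families, as a decision procedure for
-- feasibility confirms, and parity families transfer along graft isomorphisms.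

open import Defs
open import Data.Fin.Subset using (Subset)
open import Data.Product using (∃)
open import Function.Bundles using (_⇔_)

open import Algebra.Bundles using (CommutativeMonoid; CommutativeRing)
import Algebra.Properties.CommutativeMonoid.Sum as MonoidSum
open import Data.Bool using (Bool; true; false; _xor_)
open import Data.Bool.Properties using (xor-∧-commutativeRing; xor-assoc; xor-same; xor-identityʳ)
import Data.Bool.Properties as Bool
open import Data.Empty using (⊥-elim)
open import Data.Fin as Fin using (Fin; zero; suc)
open import Data.Fin.Permutation using (↔⇒≡)
open import Data.Fin.Properties using (all?; any?; ¬∀⟶∃¬)
open import Data.Fin.Subset as S using (_∈_; _∉_; _⊆_; _∩_; _∪_; _-_; ⁅_⁆; ∣_∣)
open import Data.Fin.Subset.Properties
  using ( _∈?_; _⊆?_; anySubset?; ∈⊤; ⊆⊤; ∉⊥; ⊆-antisym; Empty-unique; p─q⊆p; x∈p∧x≢y⇒x∈p-y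
        ; x∈⁅x⁆; x∈⁅y⁆⇒x≡y; x∈p∩q⁺; x∈p∩q⁻; x∈p∪q⁺; x∈p∪q⁻; ∪-identityˡ; ∪-identityʳ
        ; ∣⁅x⁆∣≡1; ∣⊥∣≡0; ∣p∣≤n; p⊂q⇒∣p∣<∣q∣ )
open import Data.Nat as ℕ using (ℕ; zero; suc; _<_; _%_; s≤s)
open import Data.Nat.Properties using (+-0-commutativeMonoid; ≤-reflexive; ≤-trans; ≤⇒≯)
open import Data.Product using (Σ; ∃₂; _×_; _,_; proj₁; proj₂)
open import Data.Product.Properties using (≡-dec)
open import Data.Sum as Sum using (_⊎_; inj₁; inj₂; [_,_])
open import Data.Vec using ([]; _∷_; here; there; lookup; tabulate)
open import Data.Vec.Properties
  using (lookup∘tabulate; tabulate∘lookup; tabulate-cong; lookup-zipWith; []=⇒lookup; lookup⇒[]=)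
open import Function using (id; _∘_; case_of_)
open import Function.Bundles using (_↔_; Inverse; Injection; Equivalence; mk⇔; mk⤖)
open import Function.Construct.Identity using (↔-id)
open import Function.Construct.Symmetry using (↔-sym; ⇔-sym)
open import Function.Definitions using (Injective)
open import Function.Properties.Bijection using (⤖⇒↔)
import Function.Properties.Equivalence as ⇔
open import Function.Properties.Inverse using (↔⇒↣)
open import Level using (0ℓ)
open import Relation.Binary.PropositionalEquality
  using (_≡_; _≢_; refl; sym; trans; cong; cong₂; subst; module ≡-Reasoning)
import Relation.Binary.Reasoning.Setoid as SetoidReasoning
open import Relation.Nullary using (¬_; Dec; yes; no; does; ¬?; _×-dec_; _⊎-dec_; _→-dec_)
open import Relation.Nullary.Decidable using (map′; decidable-stable; from-yes)
open import Relation.Unary using (Pred; Decidable)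

module ⇔-Reasoning = SetoidReasoning (⇔.⇔-setoid 0ℓ)

∈-tabulate : ∀ {n} {f : Fin n → Bool} {x} → x ∈ tabulate f ⇔ f x ≡ true
∈-tabulate {f = f} {x} = mk⇔
  (λ x∈ → trans (sym (lookup∘tabulate f x)) ([]=⇒lookup x∈))
  (λ fx≡ → lookup⇒[]= x _ (trans (lookup∘tabulate f x) fx≡))

does≡true⇔ : ∀ {A : Set} (a? : Dec A) → does a? ≡ true ⇔ A
does≡true⇔ (yes a) = mk⇔ (λ _ → a) (λ _ → refl)
does≡true⇔ (no ¬a) = mk⇔ (λ ()) (⊥-elim ∘ ¬a)

_⇔-dec_ : ∀ {A B : Set} → Dec A → Dec B → Dec (A ⇔ B)
a? ⇔-dec b? = map′ (λ (to , from) → mk⇔ to from) (λ A⇔B → Equivalence.to A⇔B , Equivalence.from A⇔B)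
                   ((a? →-dec b?) ×-dec (b? →-dec a?))

allSubsets? : ∀ {n} {P : Pred (Subset n) 0ℓ} → Decidable P → Dec (∀ p → P p)
allSubsets? P? = map′ (λ none p → decidable-stable (P? p) (λ ¬Pp → none (p , ¬Pp)))
                      (λ all (p , ¬Pp) → ¬Pp (all p))
                      (¬? (anySubset? (¬? ∘ P?)))

x∉p-x : ∀ {n} (p : Subset n) (x : Fin n) → x ∉ p - x
x∉p-x (_ ∷ p) zero ()
x∉p-x (_ ∷ p) (suc x) (there x∈) = x∉p-x p x x∈

x∈p-y⇒x≢y : ∀ {n} {p : Subset n} {x y} → x ∈ p - y → x ≢ y
x∈p-y⇒x≢y {p = p} {x} x∈ refl = x∉p-x p x x∈

∣⁅x⁆∪⁅y⁆∣≡2 : ∀ {n} {x y : Fin n} → x ≢ y → ∣ ⁅ x ⁆ ∪ ⁅ y ⁆ ∣ ≡ 2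
∣⁅x⁆∪⁅y⁆∣≡2 {x = zero} {zero} x≢y = ⊥-elim (x≢y refl)
∣⁅x⁆∪⁅y⁆∣≡2 {x = zero} {suc y} _ = cong suc (trans (cong ∣_∣ (∪-identityˡ ⁅ y ⁆)) (∣⁅x⁆∣≡1 y))
∣⁅x⁆∪⁅y⁆∣≡2 {x = suc x} {zero} _ = cong suc (trans (cong ∣_∣ (∪-identityʳ ⁅ x ⁆)) (∣⁅x⁆∣≡1 x))
∣⁅x⁆∪⁅y⁆∣≡2 {x = suc x} {suc y} x≢y = ∣⁅x⁆∪⁅y⁆∣≡2 (x≢y ∘ cong suc)

⁅x⁆∩p≡⊥ : ∀ {n} {x : Fin n} {p} → x ∉ p → ⁅ x ⁆ ∩ p ≡ S.⊥
⁅x⁆∩p≡⊥ {x = x} {p} x∉p = Empty-unique λ (y , y∈) →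
  let (y∈⁅x⁆ , y∈p) = x∈p∩q⁻ ⁅ x ⁆ p y∈ in x∉p (subst (_∈ p) (x∈⁅y⁆⇒x≡y x y∈⁅x⁆) y∈p)

⁅x⁆∩p≡⁅x⁆ : ∀ {n} {x : Fin n} {p} → x ∈ p → ⁅ x ⁆ ∩ p ≡ ⁅ x ⁆
⁅x⁆∩p≡⁅x⁆ {x = x} {p} x∈p = ⊆-antisym (proj₁ ∘ x∈p∩q⁻ ⁅ x ⁆ p)
  (λ y∈⁅x⁆ → x∈p∩q⁺ (y∈⁅x⁆ , subst (_∈ p) (sym (x∈⁅y⁆⇒x≡y x y∈⁅x⁆)) x∈p))

∈⁅x⁆∪⁅y⁆ˡ : ∀ {n} {x y : Fin n} → x ∈ ⁅ x ⁆ ∪ ⁅ y ⁆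
∈⁅x⁆∪⁅y⁆ˡ {x = x} = x∈p∪q⁺ (inj₁ (x∈⁅x⁆ x))

∈⁅x⁆∪⁅y⁆ʳ : ∀ {n} {x y : Fin n} → y ∈ ⁅ x ⁆ ∪ ⁅ y ⁆
∈⁅x⁆∪⁅y⁆ʳ {y = y} = x∈p∪q⁺ (inj₂ (x∈⁅x⁆ y))

module _ {m n} (π : Fin m ↔ Fin n) where
  open Inverse π

  ∈-image : ∀ F {x} → x ∈ image π F ⇔ from x ∈ F
  ∈-image F = mk⇔ (lookup⇒[]= _ F ∘ Equivalence.to ∈-tabulate) (Equivalence.from ∈-tabulate ∘ []=⇒lookup)

  to∈image : ∀ {F x} → x ∈ F → to x ∈ image π F
  to∈image {F} {x} x∈F = Equivalence.from (∈-image F) (subst (_∈ F) (sym (strictlyInverseʳ x)) x∈F)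

  image-sym-image : ∀ F → image (↔-sym π) (image π F) ≡ F
  image-sym-image F = begin
    tabulate (λ i → lookup (tabulate (lookup F ∘ from)) (to i))
      ≡⟨ tabulate-cong (λ i → lookup∘tabulate (lookup F ∘ from) (to i)) ⟩
    tabulate (λ i → lookup F (from (to i)))
      ≡⟨ tabulate-cong (cong (lookup F) ∘ strictlyInverseʳ) ⟩
    tabulate (lookup F)
      ≡⟨ tabulate∘lookup F ⟩
    F ∎
    where open ≡-Reasoning

module _ {c ℓ} (M : CommutativeMonoid c ℓ) where
  open CommutativeMonoid M using (Carrier; _≈_; reflexive) renaming (sym to ≈-sym; trans to ≈-trans)
  open MonoidSum M using (sum; sum-permute; sum-cong-≗)

  sum-image : ∀ {m n} (π : Fin m ↔ Fin n) (f : Bool → Carrier) (F : Subset m) →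
              sum (f ∘ lookup (image π F)) ≈ sum (f ∘ lookup F)
  sum-image π f F = ≈-trans
    (reflexive (sum-cong-≗ (cong f ∘ lookup∘tabulate (lookup F ∘ Inverse.from π))))
    (≈-sym (sum-permute (f ∘ lookup F) (↔-sym π)))

xor-commutativeMonoid : CommutativeMonoid 0ℓ 0ℓ
xor-commutativeMonoid = CommutativeRing.+-commutativeMonoid xor-∧-commutativeRing

module Xor = MonoidSum xor-commutativeMonoid
module Count = MonoidSum +-0-commutativeMonoid

boolToℕ : Bool → ℕ
boolToℕ false = 0
boolToℕ true = 1

∣p∣≡count : ∀ {n} (p : Subset n) → ∣ p ∣ ≡ Count.sum (boolToℕ ∘ lookup p)
∣p∣≡count [] = refl
∣p∣≡count (false ∷ p) = ∣p∣≡count p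
∣p∣≡count (true ∷ p) = cong suc (∣p∣≡count p)

∣image∣≡∣p∣ : ∀ {m n} (π : Fin m ↔ Fin n) (p : Subset m) → ∣ image π p ∣ ≡ ∣ p ∣
∣image∣≡∣p∣ π p = trans (∣p∣≡count (image π p))
  (trans (sum-image +-0-commutativeMonoid π boolToℕ p) (sym (∣p∣≡count p)))

parity : ∀ {n} → Subset n → Bool
parity F = Xor.sum (lookup F)

parity-image : ∀ {m n} (π : Fin m ↔ Fin n) (F : Subset m) → parity (image π F) ≡ parity F
parity-image π = sum-image xor-commutativeMonoid π id

parity-△ : ∀ {n} (F X : Subset n) → parity (F △ X) ≡ parity F xor parity X
parity-△ F X = trans (Xor.sum-cong-≗ (λ i → lookup-zipWith _xor_ i F X))
                     (Xor.∑-distrib-+ (lookup F) (lookup X))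

xor-cancelʳ : ∀ a b → (a xor b) xor b ≡ a
xor-cancelʳ a b = trans (xor-assoc a b b) (trans (cong (a xor_) (xor-same b)) (xor-identityʳ a))

△-cancelʳ : ∀ {n} (F X : Subset n) → (F △ X) △ X ≡ F
△-cancelʳ [] [] = refl
△-cancelʳ (a ∷ F) (x ∷ X) = cong₂ _∷_ (xor-cancelʳ a x) (△-cancelʳ F X)

parity-△-shift : ∀ {n} (F X : Subset n) c → (parity (F △ X) ≡ c) ⇔ (parity F ≡ c xor parity X)
parity-△-shift F X c = mk⇔
  (λ e → trans (sym (xor-cancelʳ (parity F) (parity X)))
               (cong (_xor parity X) (trans (sym (parity-△ F X)) e)))
  (λ e → trans (parity-△ F X) (trans (cong (_xor parity X) e) (xor-cancelʳ c (parity X))))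

-- Parity families of set systems

ParityFamily : SetSystem → Set
ParityFamily D = Σ Bool λ c → ∀ F → Feasible D F ⇔ (parity F ≡ c)

MK3-feasible⇔even : ∀ F → Feasible MK3 F ⇔ (parity F ≡ false)
MK3-feasible⇔even F = mk⇔ feasible⇒even (even⇒feasible F)
  where
  feasible⇒even : ∀ {F} → Feasible MK3 F → parity F ≡ false
  feasible⇒even (inj₁ refl) = refl
  feasible⇒even (inj₂ (inj₁ refl)) = refl
  feasible⇒even (inj₂ (inj₂ (inj₁ refl))) = refl
  feasible⇒even (inj₂ (inj₂ (inj₂ refl))) = refl

  even⇒feasible : ∀ F → parity F ≡ false → Feasible MK3 F
  even⇒feasible (false ∷ false ∷ false ∷ []) _ = inj₁ refl
  even⇒feasible (true ∷ true ∷ false ∷ []) _ = inj₂ (inj₁ refl)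
  even⇒feasible (true ∷ false ∷ true ∷ []) _ = inj₂ (inj₂ (inj₁ refl))
  even⇒feasible (false ∷ true ∷ true ∷ []) _ = inj₂ (inj₂ (inj₂ refl))
  even⇒feasible (true ∷ false ∷ false ∷ []) ()
  even⇒feasible (false ∷ true ∷ false ∷ []) ()
  even⇒feasible (false ∷ false ∷ true ∷ []) ()
  even⇒feasible (true ∷ true ∷ true ∷ []) ()

≅-parityFamily : ∀ {D D'} → D ≅ D' → ParityFamily D' → ParityFamily D
≅-parityFamily {D} {D'} (π , feasible⇔) (c , family) = c , λ F → begin
  Feasible D F                ≈⟨ feasible⇔ F ⟩
  Feasible D' (image π F)     ≈⟨ family (image π F) ⟩
  parity (image π F) ≡ c      ≡⟨ cong (_≡ c) (parity-image π F) ⟩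
  parity F ≡ c                ∎
  where open ⇔-Reasoning

twist-parityFamily : ∀ {D} → ParityFamily D → ∀ X → ParityFamily (twist D X)
twist-parityFamily {D} (c , family) X = c xor parity X , λ F → begin
  Feasible D (F △ X)          ≈⟨ family (F △ X) ⟩
  parity (F △ X) ≡ c          ≈⟨ parity-△-shift F X c ⟩
  parity F ≡ c xor parity X   ∎
  where open ⇔-Reasoning

untwist-parityFamily : ∀ {D} X → ParityFamily (twist D X) → ParityFamily D
untwist-parityFamily {D} X (c , family) = c xor parity X , λ F → begin
  Feasible D F                ≡⟨ cong (Feasible D) (△-cancelʳ F X) ⟨
  Feasible D ((F △ X) △ X)    ≈⟨ family (F △ X) ⟩
  parity (F △ X) ≡ c          ≈⟨ parity-△-shift F X c ⟩
  parity F ≡ c xor parity X   ∎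
  where open ⇔-Reasoning

twist≅MK3⇒parityFamily : ∀ {D X} → twist D X ≅ MK3 → ParityFamily D
twist≅MK3⇒parityFamily {X = X} iso =
  untwist-parityFamily X (≅-parityFamily iso (false , MK3-feasible⇔even))

parityFamily⇒twist≅MK3 : ∀ {D} → ParityFamily D → Fin (size D) ↔ Fin 3 → ∃ λ X → twist D X ≅ MK3
parityFamily⇒twist≅MK3 {D} (c , family) π = X , π , λ F → begin
  Feasible D (F △ X)          ≈⟨ proj₂ (twist-parityFamily (c , family) X) F ⟩
  parity F ≡ c xor parity X   ≡⟨ cong (λ b → parity F ≡ c xor b) parity-X ⟩
  parity F ≡ c xor c          ≡⟨ cong (parity F ≡_) (xor-same c) ⟩
  parity F ≡ false            ≡⟨ cong (_≡ false) (parity-image π F) ⟨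
  parity (image π F) ≡ false  ≈⟨ MK3-feasible⇔even (image π F) ⟨
  Feasible MK3 (image π F)    ∎
  where
  open ⇔-Reasoning
  X : Subset (size D)
  X = image (↔-sym π) (c ∷ false ∷ false ∷ [])
  parity-X : parity X ≡ c
  parity-X = trans (parity-image (↔-sym π) (c ∷ false ∷ false ∷ [])) (xor-identityʳ c)

end₁ end₂ : (G : Graph) → Fin (nE G) → Fin (nV G)
end₁ G e = proj₁ (ends G e)
end₂ G e = proj₂ (ends G e)

Incident : (G : Graph) → Fin (nE G) → Fin (nV G) → Set
Incident G e v = end₁ G e ≡ v ⊎ end₂ G e ≡ v

incident? : ∀ G e v → Dec (Incident G e v)
incident? G e v = (end₁ G e Fin.≟ v) ⊎-dec (end₂ G e Fin.≟ v)

joins? : ∀ G e u w → Dec (Joins G e u w)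
joins? G e u w = ≡-dec Fin._≟_ Fin._≟_ (ends G e) (u , w) ⊎-dec ≡-dec Fin._≟_ Fin._≟_ (ends G e) (w , u)

module _ (G : Graph) where

  Meets : Fin (nE G) → Fin (nE G) → Set
  Meets e f = ∃ λ v → Incident G e v × Incident G f v

  Joins-sym : ∀ {e u w} → Joins G e u w → Joins G e w u
  Joins-sym (inj₁ eq) = inj₂ eq
  Joins-sym (inj₂ eq) = inj₁ eq

  Joins-ends : ∀ e → Joins G e (end₁ G e) (end₂ G e)
  Joins-ends e = inj₁ refl

  Joins⇒Incident : ∀ {e u w} → Joins G e u w → Incident G e u
  Joins⇒Incident (inj₁ refl) = inj₁ refl
  Joins⇒Incident (inj₂ refl) = inj₂ refl

  Incident⇒Joins : ∀ {e x y} → Incident G e x → Incident G e y → x ≢ y → Joins G e x y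
  Incident⇒Joins (inj₁ refl) (inj₁ refl) x≢y = ⊥-elim (x≢y refl)
  Incident⇒Joins (inj₁ refl) (inj₂ refl) _ = inj₁ refl
  Incident⇒Joins (inj₂ refl) (inj₁ refl) _ = inj₂ refl
  Incident⇒Joins (inj₂ refl) (inj₂ refl) x≢y = ⊥-elim (x≢y refl)

  Incident-Joins : ∀ {e u w z} → Joins G e u w → Incident G e z → z ≡ u ⊎ z ≡ w
  Incident-Joins (inj₁ refl) (inj₁ refl) = inj₁ refl
  Incident-Joins (inj₁ refl) (inj₂ refl) = inj₂ refl
  Incident-Joins (inj₂ refl) (inj₁ refl) = inj₂ refl
  Incident-Joins (inj₂ refl) (inj₂ refl) = inj₁ refl

  other-end : ∀ {e v} → Incident G e v → Fin (nV G)
  other-end {e} (inj₁ _) = end₂ G e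
  other-end {e} (inj₂ _) = end₁ G e

  Joins-other-end : ∀ {e v} (i : Incident G e v) → Joins G e v (other-end i)
  Joins-other-end (inj₁ refl) = inj₁ refl
  Joins-other-end (inj₂ refl) = inj₂ refl

  Joins⇒≢ : ∀ {e u w} → end₁ G e ≢ end₂ G e → Joins G e u w → w ≢ u
  Joins⇒≢ loopless (inj₁ refl) w≡u = loopless (sym w≡u)
  Joins⇒≢ loopless (inj₂ refl) w≡u = loopless w≡u

  Joins-parallel : ∀ {e f u w} → Joins G f u w → Joins G e u w → Joins G f (end₁ G e) (end₂ G e)
  Joins-parallel j (inj₁ refl) = j
  Joins-parallel j (inj₂ refl) = Joins-sym j

  Closed : Subset (nE G) → Subset (nV G) → Set
  Closed F S = ∀ {e u w} → e ∈ F → Joins G e u w → u ∈ S → w ∈ S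

  -- conditions (i) and (ii) of a T-spanning subgraph, for a component with vertex set S
  Admissible : Subset (nV G) → Subset (nV G) → Set
  Admissible T S = ∣ S ∩ T ∣ % 2 ≡ 1 ⊎ ((∀ u → u ∈ S → u ∉ T) × Closed (AllE G) S)

module _ {G : Graph} where

  Reach-snoc : ∀ {F u x w e} → Reach G F u x → e ∈ F → Joins G e x w → Reach G F u w
  Reach-snoc here e∈F j = step _ e∈F j here
  Reach-snoc (step e' e'∈F j' r) e∈F j = step e' e'∈F j' (Reach-snoc r e∈F j)

  Reach-sym : ∀ {F u x} → Reach G F u x → Reach G F x u
  Reach-sym here = here
  Reach-sym (step e e∈F j r) = Reach-snoc (Reach-sym r) e∈F (Joins-sym G j)

  Reach-ends : ∀ {F e u w} → Joins G e u w → Reach G F u w → Reach G F (end₁ G e) (end₂ G e)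
  Reach-ends (inj₁ refl) r = r
  Reach-ends (inj₂ refl) r = Reach-sym r

  Reach-closed : ∀ {F S u x} → Closed G F S → u ∈ S → Reach G F u x → x ∈ S
  Reach-closed closed u∈S here = u∈S
  Reach-closed closed u∈S (step e e∈F j r) = Reach-closed closed (closed e∈F j u∈S) r

Reach-map : ∀ {G H F F'} (f : Fin (nV G) → Fin (nV H)) (g : Fin (nE G) → Fin (nE H)) →
  (∀ {e u w} → Joins G e u w → Joins H (g e) (f u) (f w)) → (∀ {e} → e ∈ F → g e ∈ F') →
  ∀ {u x} → Reach G F u x → Reach H F' (f u) (f x)
Reach-map f g joins mem here = here
Reach-map f g joins mem (step e e∈F j r) = step (g e) (mem e∈F) (joins j) (Reach-map f g joins mem r)

Reach-mono : ∀ {G F F'} → F ⊆ F' → ∀ {u x} → Reach G F u x → Reach G F' u x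
Reach-mono F⊆F' = Reach-map id id id F⊆F'

module _ {G : Graph} {T : Subset (nV G)} {F : Subset (nE G)} {v : Fin (nV G)} {S : Subset (nV G)}
         (closed : Closed G F S) (v∈S : v ∈ S) (reach : ∀ {u} → u ∈ S → Reach G F v u) where

  componentOK⇔admissible : ComponentOK G T F v ⇔ Admissible G T S
  componentOK⇔admissible = mk⇔ to from
    where
    to : ComponentOK G T F v → Admissible G T S
    to (inj₁ (C , C-component , odd)) = inj₁ (subst (λ X → ∣ X ∩ T ∣ % 2 ≡ 1) C≡S odd)
      where
      C≡S : C ≡ S
      C≡S = ⊆-antisym (λ {u} u∈C → Reach-closed closed v∈S (proj₁ (C-component u) u∈C))
                      (λ {u} u∈S → proj₂ (C-component u) (reach u∈S))
    to (inj₂ (avoids , full)) = inj₂ ((λ u u∈S → avoids u (reach u∈S)) , G-closed)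
      where
      G-closed : Closed G (AllE G) S
      G-closed {w = w} _ j u∈S =
        Reach-closed closed v∈S (full w (Reach-snoc (Reach-mono ⊆⊤ (reach u∈S)) ∈⊤ j))

    from : Admissible G T S → ComponentOK G T F v
    from (inj₁ odd) = inj₁ (S , (λ u → reach , Reach-closed closed v∈S) , odd)
    from (inj₂ (avoids , G-closed)) =
      inj₂ ((λ u r → avoids u (Reach-closed closed v∈S r)) , (λ u r → reach (Reach-closed G-closed v∈S r)))

module _ {G : Graph} {F : Subset (nE G)} where

  ⁅⁆-closed : ∀ {v} → (∀ {f} → f ∈ F → ¬ Incident G f v) → Closed G F ⁅ v ⁆
  ⁅⁆-closed {v} untouched f∈F j u∈⁅v⁆ =
    ⊥-elim (untouched f∈F (subst (Incident G _) (x∈⁅y⁆⇒x≡y v u∈⁅v⁆) (Joins⇒Incident G j)))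

  ⁅⁆-reach : ∀ {v u} → u ∈ ⁅ v ⁆ → Reach G F v u
  ⁅⁆-reach {v} u∈⁅v⁆ = subst (Reach G F v) (sym (x∈⁅y⁆⇒x≡y v u∈⁅v⁆)) here

-- Deciding feasibility

module Component (G : Graph) (F : Subset (nE G)) where

  Neighbour : Subset (nV G) → Fin (nV G) → Set
  Neighbour S w = ∃ λ e → e ∈ F × ∃ λ u → u ∈ S × Joins G e u w

  neighbour? : ∀ S w → Dec (Neighbour S w)
  neighbour? S w = any? λ e → e ∈? F ×-dec any? λ u → u ∈? S ×-dec joins? G e u w

  grow : Subset (nV G) → Subset (nV G)
  grow S = tabulate λ w → does (w ∈? S ⊎-dec neighbour? S w)

  ∈-grow : ∀ {S w} → w ∈ grow S ⇔ (w ∈ S ⊎ Neighbour S w)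
  ∈-grow {S} {w} = ⇔.trans ∈-tabulate (does≡true⇔ (w ∈? S ⊎-dec neighbour? S w))

  grow-⊇ : ∀ {S} → S ⊆ grow S
  grow-⊇ w∈S = Equivalence.from ∈-grow (inj₁ w∈S)

  closed⇒grow⊆ : ∀ {S} → Closed G F S → grow S ⊆ S
  closed⇒grow⊆ closed w∈ with Equivalence.to ∈-grow w∈
  ... | inj₁ w∈S = w∈S
  ... | inj₂ (e , e∈F , u , u∈S , j) = closed e∈F j u∈S

  grow⊆⇒closed : ∀ {S} → grow S ⊆ S → Closed G F S
  grow⊆⇒closed grow⊆ e∈F j u∈S = grow⊆ (Equivalence.from ∈-grow (inj₂ (_ , e∈F , _ , u∈S , j)))

  closed? : ∀ S → Dec (Closed G F S)
  closed? S = map′ grow⊆⇒closed closed⇒grow⊆ (grow S ⊆? S)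

  grow-closed : ∀ {S} → Closed G F S → Closed G F (grow S)
  grow-closed closed = subst (Closed G F) (⊆-antisym grow-⊇ (closed⇒grow⊆ closed)) closed

  closed⊎grows : ∀ S → Closed G F S ⊎ ∣ S ∣ < ∣ grow S ∣
  closed⊎grows S with any? (λ w → w ∈? grow S ×-dec ¬? (w ∈? S))
  ... | yes (w , w∈ , w∉S) = inj₂ (p⊂q⇒∣p∣<∣q∣ (grow-⊇ , w , w∈ , w∉S))
  ... | no none = inj₁ (grow⊆⇒closed λ {w} w∈ → decidable-stable (w ∈? S) (λ w∉S → none (w , w∈ , w∉S)))

  component : ℕ → Fin (nV G) → Subset (nV G)
  component zero v = ⁅ v ⁆
  component (suc k) v = grow (component k v)

  ∈-component : ∀ k v → v ∈ component k v
  ∈-component zero v = x∈⁅x⁆ v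
  ∈-component (suc k) v = grow-⊇ (∈-component k v)

  component-reach : ∀ k {v u} → u ∈ component k v → Reach G F v u
  component-reach zero {v} u∈ rewrite x∈⁅y⁆⇒x≡y v u∈ = here
  component-reach (suc k) u∈ with Equivalence.to ∈-grow u∈
  ... | inj₁ u∈C = component-reach k u∈C
  ... | inj₂ (e , e∈F , w , w∈C , j) = Reach-snoc (component-reach k w∈C) e∈F j

  -- every round that does not reach a closed set adds a vertex, so nV G rounds suffice
  closed⊎large : ∀ k v → Closed G F (component k v) ⊎ k < ∣ component k v ∣
  closed⊎large zero v = inj₂ (≤-reflexive (sym (∣⁅x⁆∣≡1 v)))
  closed⊎large (suc k) v with closed⊎large k v
  ... | inj₁ closed = inj₁ (grow-closed closed)
  ... | inj₂ k<∣C∣ = Sum.map grow-closed (≤-trans (s≤s k<∣C∣)) (closed⊎grows (component k v))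

  component-closed : ∀ v → Closed G F (component (nV G) v)
  component-closed v with closed⊎large (nV G) v
  ... | inj₁ closed = closed
  ... | inj₂ large = ⊥-elim (≤⇒≯ (∣p∣≤n (component (nV G) v)) large)

  reach? : ∀ v u → Dec (Reach G F v u)
  reach? v u = map′ (component-reach (nV G))
                    (Reach-closed (component-closed v) (∈-component (nV G) v))
                    (u ∈? component (nV G) v)

open Component using (reach?; closed?)

admissible? : ∀ G T S → Dec (Admissible G T S)
admissible? G T S = ∣ S ∩ T ∣ % 2 ℕ.≟ 1
  ⊎-dec (all? (λ u → u ∈? S →-dec ¬? (u ∈? T)) ×-dec closed? G (AllE G) S)

componentOK? : ∀ G T F v → Dec (ComponentOK G T F v)
componentOK? G T F v = map′ (Equivalence.from admissible⇔) (Equivalence.to admissible⇔)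
                            (admissible? G T (component (nV G) v))
  where
  open Component G F
  admissible⇔ : ComponentOK G T F v ⇔ Admissible G T (component (nV G) v)
  admissible⇔ = componentOK⇔admissible {T = T} (component-closed v) (∈-component (nV G) v)
                                       (component-reach (nV G))

feasible? : ∀ G T F → Dec (Feasible (graftDM G T) F)
feasible? G T F =
  all? (λ e → e ∈? F →-dec ¬? (reach? G (F - e) (end₁ G e) (end₂ G e)))
  ×-dec all? (componentOK? G T F)

Δ₁-parityFamily : ParityFamily (graftDM K3 S.⊤)
Δ₁-parityFamily = false , from-yes (allSubsets? λ F → feasible? K3 S.⊤ F ⇔-dec (parity F Bool.≟ false))

Δ₂-parityFamily : ParityFamily (graftDM K13 S.⊤)
Δ₂-parityFamily = false , from-yes (allSubsets? λ F → feasible? K13 S.⊤ F ⇔-dec (parity F Bool.≟ false))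

Δ₃-parityFamily : ParityFamily (graftDM K13 leavesK13)
Δ₃-parityFamily = true , from-yes (allSubsets? λ F → feasible? K13 leavesK13 F ⇔-dec (parity F Bool.≟ true))

module _ {G : Graph} {F : Subset (nE G)} (forest : Forest G F) where

  forest⇒loopless : ∀ {e} → e ∈ F → end₁ G e ≢ end₂ G e
  forest⇒loopless {e} e∈F ends≡ = forest e e∈F (subst (Reach G (F - e) _) ends≡ here)

  forest⇒simple : ∀ {e f} → e ∈ F → f ∈ F → f ≢ e → ¬ Joins G f (end₁ G e) (end₂ G e)
  forest⇒simple {e} {f} e∈F f∈F f≢e j = forest e e∈F (step f (x∈p∧x≢y⇒x∈p-y f∈F f≢e) j here)

⊥-feasible : ∀ {G T} → (∀ v → v ∈ T) → Feasible (graftDM G T) S.⊥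
⊥-feasible {G} {T} all∈T =
  (λ e e∈⊥ → ⊥-elim (∉⊥ e∈⊥)) ,
  λ v → Equivalence.from (componentOK⇔admissible {G = G} (⁅⁆-closed {G = G} (⊥-elim ∘ ∉⊥)) (x∈⁅x⁆ v) ⁅⁆-reach)
                         (inj₁ (cong (_% 2) (trans (cong ∣_∣ (⁅x⁆∩p≡⁅x⁆ (all∈T v))) (∣⁅x⁆∣≡1 v))))

module _ {G : Graph} {T} {F} (feasible : Feasible (graftDM G T) F) where

  untouched-vertex∈T : ∀ {v e w} → (∀ {f} → f ∈ F → ¬ Incident G f v) → Joins G e v w → w ≢ v → v ∈ T
  untouched-vertex∈T {v} {e} {w} untouched j w≢v = decidable-stable (v ∈? T) λ v∉T →
    not-admissible v∉T (Equivalence.to (componentOK⇔admissible (⁅⁆-closed untouched) (x∈⁅x⁆ v) ⁅⁆-reach)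
                                      (proj₂ feasible v))
    where
    not-admissible : v ∉ T → ¬ Admissible G T ⁅ v ⁆
    not-admissible v∉T (inj₁ odd) with trans (cong (λ X → ∣ X ∣ % 2) (sym (⁅x⁆∩p≡⊥ v∉T))) odd
    ... | ⊥-odd rewrite ∣⊥∣≡0 (nV G) with ⊥-odd
    ... | ()
    not-admissible v∉T (inj₂ (_ , G-closed)) = w≢v (x∈⁅y⁆⇒x≡y v (G-closed ∈⊤ j (x∈⁅x⁆ v)))

  isolated-edge-infeasible : (∀ v → v ∈ T) → ∀ {e} → e ∈ F → end₁ G e ≢ end₂ G e →
    ¬ (∀ {f} → f ∈ F → f ≢ e → ¬ Meets G e f)
  isolated-edge-infeasible all∈T {e} e∈F loopless isolated =
    not-admissible (Equivalence.to (componentOK⇔admissible closed a∈S reach) (proj₂ feasible a))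
    where
    a b : Fin (nV G)
    a = end₁ G e
    b = end₂ G e

    S : Subset (nV G)
    S = ⁅ a ⁆ ∪ ⁅ b ⁆

    a∈S : a ∈ S
    a∈S = ∈⁅x⁆∪⁅y⁆ˡ

    ∈S⇒end : ∀ {u} → u ∈ S → u ≡ a ⊎ u ≡ b
    ∈S⇒end u∈S with x∈p∪q⁻ ⁅ a ⁆ ⁅ b ⁆ u∈S
    ... | inj₁ u∈⁅a⁆ = inj₁ (x∈⁅y⁆⇒x≡y a u∈⁅a⁆)
    ... | inj₂ u∈⁅b⁆ = inj₂ (x∈⁅y⁆⇒x≡y b u∈⁅b⁆)

    end⇒∈S : ∀ {u} → Incident G e u → u ∈ S
    end⇒∈S (inj₁ refl) = ∈⁅x⁆∪⁅y⁆ˡ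
    end⇒∈S (inj₂ refl) = ∈⁅x⁆∪⁅y⁆ʳ

    closed : Closed G F S
    closed {g} g∈F j u∈S with g Fin.≟ e
    ... | yes refl = end⇒∈S (Joins⇒Incident G (Joins-sym G j))
    ... | no g≢e = ⊥-elim (isolated g∈F g≢e meets)
      where
      meets : Meets G e g
      meets with ∈S⇒end u∈S
      ... | inj₁ refl = a , inj₁ refl , Joins⇒Incident G j
      ... | inj₂ refl = b , inj₂ refl , Joins⇒Incident G j

    reach : ∀ {u} → u ∈ S → Reach G F a u
    reach u∈S with ∈S⇒end u∈S
    ... | inj₁ refl = here
    ... | inj₂ refl = step e e∈F (Joins-ends G e) here

    S∩T≡S : S ∩ T ≡ S
    S∩T≡S = ⊆-antisym (proj₁ ∘ x∈p∩q⁻ S T) (λ {u} u∈S → x∈p∩q⁺ (u∈S , all∈T u))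

    not-admissible : ¬ Admissible G T S
    not-admissible (inj₁ odd) with trans (cong (λ X → ∣ X ∣ % 2) (sym S∩T≡S)) odd
    ... | S-odd rewrite ∣⁅x⁆∪⁅y⁆∣≡2 loopless with S-odd
    ... | ()
    not-admissible (inj₂ (avoids , _)) = avoids a a∈S (all∈T a)

-- Graft isomorphisms

GraftIso-sym : ∀ {G T H T'} → GraftIso G T H T' → GraftIso H T' G T
GraftIso-sym {G} {T} {H} {T'} (φ , ψ , joins , inT) = ↔-sym φ , ↔-sym ψ , joins⁻ , inT⁻
  where
  open Inverse
  joins⁻ : ∀ e' → Joins G (from ψ e') (from φ (end₁ H e')) (from φ (end₂ H e'))
  joins⁻ e' with subst (λ f → Joins H f _ _) (strictlyInverseˡ ψ e') (joins (from ψ e'))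
  ... | inj₁ eq rewrite eq | strictlyInverseʳ φ (end₁ G (from ψ e')) | strictlyInverseʳ φ (end₂ G (from ψ e')) = inj₁ refl
  ... | inj₂ eq rewrite eq | strictlyInverseʳ φ (end₁ G (from ψ e')) | strictlyInverseʳ φ (end₂ G (from ψ e')) = inj₂ refl
  inT⁻ : ∀ v' → (v' ∈ T' → from φ v' ∈ T) × (from φ v' ∈ T → v' ∈ T')
  inT⁻ v' = (λ v'∈T' → proj₂ (inT (from φ v')) (subst (_∈ T') (sym (strictlyInverseˡ φ v')) v'∈T'))
          , (λ v∈T → subst (_∈ T') (strictlyInverseˡ φ v') (proj₁ (inT (from φ v')) v∈T))

Reach-transport : ∀ {G T H T'} (iso : GraftIso G T H T') {F F'} →
  (∀ {e} → e ∈ F → Inverse.to (proj₁ (proj₂ iso)) e ∈ F') →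
  ∀ {u x} → Reach G F u x → Reach H F' (Inverse.to (proj₁ iso) u) (Inverse.to (proj₁ iso) x)
Reach-transport {G} {H = H} (φ , ψ , joins , _) = Reach-map (Inverse.to φ) (Inverse.to ψ) Joins-transport
  where
  Joins-transport : ∀ {e u w} → Joins G e u w → Joins H (Inverse.to ψ e) (Inverse.to φ u) (Inverse.to φ w)
  Joins-transport {e} (inj₁ refl) = joins e
  Joins-transport {e} (inj₂ refl) = Joins-sym H (joins e)

module _ {G T H T'} (iso : GraftIso G T H T') where
  open Inverse
  private
    φ : Fin (nV G) ↔ Fin (nV H)
    φ = proj₁ iso

    ψ : Fin (nE G) ↔ Fin (nE H)
    ψ = proj₁ (proj₂ iso)

    iso⁻ : GraftIso H T' G T
    iso⁻ = GraftIso-sym {G} {T} {H} {T'} iso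

    joins⁻ : ∀ e' → Joins G (from ψ e') (from φ (end₁ H e')) (from φ (end₂ H e'))
    joins⁻ = proj₁ (proj₂ (proj₂ iso⁻))

    inT⁻ : ∀ v' → (v' ∈ T' → from φ v' ∈ T) × (from φ v' ∈ T → v' ∈ T')
    inT⁻ = proj₂ (proj₂ (proj₂ iso⁻))

    pull : ∀ {F F'} → (∀ {e'} → e' ∈ F' → from ψ e' ∈ F) →
           ∀ {u' x'} → Reach H F' u' x' → Reach G F (from φ u') (from φ x')
    pull = Reach-transport {H} {T'} {G} {T} iso⁻

    push-to : ∀ {F v u'} → Reach G F v (from φ u') → Reach H (image ψ F) (to φ v) u'
    push-to {u' = u'} r =
      subst (Reach H _ _) (strictlyInverseˡ φ u') (Reach-transport {G} {T} {H} {T'} iso (to∈image ψ) r)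

    pull-from : ∀ {F F' v u'} → (∀ {e'} → e' ∈ F' → from ψ e' ∈ F) →
                Reach H F' (to φ v) u' → Reach G F v (from φ u')
    pull-from {v = v} mem r = subst (λ z → Reach G _ z _) (strictlyInverseʳ φ v) (pull mem r)

  forest-transport : ∀ {F} → Forest G F → Forest H (image ψ F)
  forest-transport {F} forest e' e'∈ r =
    forest e (Equivalence.to (∈-image ψ F) e'∈) (Reach-ends (joins⁻ e') (pull pulled r))
    where
    e : Fin (nE G)
    e = from ψ e'
    pulled : ∀ {g'} → g' ∈ image ψ F - e' → from ψ g' ∈ F - e
    pulled {g'} g'∈ = x∈p∧x≢y⇒x∈p-y (Equivalence.to (∈-image ψ F) (p─q⊆p _ _ g'∈))
                                    (x∈p-y⇒x≢y g'∈ ∘ Injection.injective (↔⇒↣ (↔-sym ψ)))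

  componentOK-transport : ∀ {F v} → ComponentOK G T F v → ComponentOK H T' (image ψ F) (to φ v)
  componentOK-transport {F} {v} (inj₁ (C , C-component , odd)) = inj₁ (image φ C , C'-component , odd')
    where
    C'-component : ∀ u' → (u' ∈ image φ C → Reach H (image ψ F) (to φ v) u')
                        × (Reach H (image ψ F) (to φ v) u' → u' ∈ image φ C)
    C'-component u' =
      (λ u'∈ → push-to (proj₁ (C-component (from φ u')) (Equivalence.to (∈-image φ C) u'∈))) ,
      (λ r → Equivalence.from (∈-image φ C)
               (proj₂ (C-component (from φ u')) (pull-from (Equivalence.to (∈-image ψ F)) r)))

    C'∩T'≡ : image φ C ∩ T' ≡ image φ (C ∩ T)
    C'∩T'≡ = ⊆-antisym
      (λ {u'} u'∈ → let (u'∈C' , u'∈T') = x∈p∩q⁻ (image φ C) T' u'∈ in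
        Equivalence.from (∈-image φ (C ∩ T)) (x∈p∩q⁺ (Equivalence.to (∈-image φ C) u'∈C' , proj₁ (inT⁻ u') u'∈T')))
      (λ {u'} u'∈ → let (u∈C , u∈T) = x∈p∩q⁻ C T (Equivalence.to (∈-image φ (C ∩ T)) u'∈) in
        x∈p∩q⁺ (Equivalence.from (∈-image φ C) u∈C , proj₂ (inT⁻ u') u∈T))

    odd' : ∣ image φ C ∩ T' ∣ % 2 ≡ 1
    odd' = begin
      ∣ image φ C ∩ T' ∣ % 2    ≡⟨ cong (λ X → ∣ X ∣ % 2) C'∩T'≡ ⟩
      ∣ image φ (C ∩ T) ∣ % 2   ≡⟨ cong (_% 2) (∣image∣≡∣p∣ φ (C ∩ T)) ⟩
      ∣ C ∩ T ∣ % 2             ≡⟨ odd ⟩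
      1                         ∎
      where open ≡-Reasoning
  componentOK-transport {F} {v} (inj₂ (avoids , full)) = inj₂
    ( (λ u' r u'∈T' → avoids (from φ u') (pull-from (Equivalence.to (∈-image ψ F)) r) (proj₁ (inT⁻ u') u'∈T'))
    , (λ u' r → push-to (full (from φ u') (pull-from (λ _ → ∈⊤) r))) )

  feasible-transport : ∀ {F} → Feasible (graftDM G T) F → Feasible (graftDM H T') (image ψ F)
  feasible-transport (forest , spanning) =
    forest-transport forest ,
    λ v' → subst (ComponentOK H T' _) (strictlyInverseˡ φ v') (componentOK-transport (spanning (from φ v')))

graftIso⇒≅ : ∀ {G T H T'} → GraftIso G T H T' → graftDM G T ≅ graftDM H T'
graftIso⇒≅ {G} {T} {H} {T'} iso = ψ , λ F → mk⇔ (feasible-transport iso)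
  (subst (Feasible (graftDM G T)) (image-sym-image ψ F) ∘ feasible-transport (GraftIso-sym {G} {T} {H} {T'} iso))
  where
  ψ : Fin (nE G) ↔ Fin (nE H)
  ψ = proj₁ (proj₂ iso)

injective⇒GraftIso : ∀ {G T} (H : Graph) (T' : Subset (nV H)) → NoIsolated G →
  (f : Fin (nV H) → Fin (nV G)) → Injective _≡_ _≡_ f →
  (ψ : Fin (nE H) ↔ Fin (nE G)) → (∀ e → Joins G (Inverse.to ψ e) (f (end₁ H e)) (f (end₂ H e))) →
  (∀ x → x ∈ T' ⇔ f x ∈ T) → GraftIso G T H T'
injective⇒GraftIso {G} {T} H T' noIsolated f injective ψ joins inT =
  GraftIso-sym {H} {T'} {G} {T} (φ , ψ , joins , λ x → Equivalence.to (inT x) , Equivalence.from (inT x))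
  where
  -- every vertex of G is an end of the image of some edge of H
  surjective : ∀ u → ∃ λ x → f x ≡ u
  surjective u with noIsolated u
  ... | e , _ , j with Incident-Joins G (subst (λ e' → Joins G e' _ _) (Inverse.strictlyInverseˡ ψ e)
                                               (joins (Inverse.from ψ e)))
                                        (Joins⇒Incident G j)
  ...   | inj₁ u≡ = end₁ H (Inverse.from ψ e) , sym u≡
  ...   | inj₂ u≡ = end₂ H (Inverse.from ψ e) , sym u≡

  φ : Fin (nV H) ↔ Fin (nV G)
  φ = ⤖⇒↔ (mk⤖ (injective , λ u → proj₁ (surjective u) , λ { refl → proj₂ (surjective u) }))

-- Grafts with three edges and a parity family

Graph₃ : (n : ℕ) → (Fin 3 → Fin n × Fin n) → Graph
Graph₃ n ends = record { nV = n ; nE = 3 ; ends = ends }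

three-edges-elim : (P : Graph → Set) → (∀ n ends → P (Graph₃ n ends)) → ∀ G → Fin (nE G) ↔ Fin 3 → P G
three-edges-elim P h record { nV = n ; nE = m ; ends = ends } π with ↔⇒≡ π
... | refl = h n ends

e₀ e₁ e₂ : Fin 3
e₀ = zero
e₁ = suc zero
e₂ = suc (suc zero)

module Simple₃ {n ends} {T : Subset n} (noIsolated : NoIsolated (Graph₃ n ends))
  (loopless : ∀ e → end₁ (Graph₃ n ends) e ≢ end₂ (Graph₃ n ends) e)
  (simple : ∀ {e f} → f ≢ e → ¬ Joins (Graph₃ n ends) f (end₁ (Graph₃ n ends) e) (end₂ (Graph₃ n ends) e))
  where

  private
    G : Graph
    G = Graph₃ n ends

  module Star (o : Fin n) (at-o : ∀ e → Incident G e o) where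

    leaf : Fin 3 → Fin n
    leaf e = other-end G (at-o e)

    Joins-leaf : ∀ e → Joins G e o (leaf e)
    Joins-leaf e = Joins-other-end G (at-o e)

    leaf≢centre : ∀ e → leaf e ≢ o
    leaf≢centre e = Joins⇒≢ G (loopless e) (Joins-leaf e)

    leaf-injective : ∀ {e f} → leaf e ≡ leaf f → e ≡ f
    leaf-injective {e} {f} leaf≡ with f Fin.≟ e
    ... | yes f≡e = sym f≡e
    ... | no f≢e = ⊥-elim (simple f≢e (Joins-parallel G (subst (Joins G f o) (sym leaf≡) (Joins-leaf f)) (Joins-leaf e)))

    vertex : Fin 4 → Fin n
    vertex zero = o
    vertex (suc e) = leaf e

    vertex-injective : ∀ {x y} → vertex x ≡ vertex y → x ≡ y
    vertex-injective {zero} {zero} _ = refl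
    vertex-injective {zero} {suc e} o≡leaf = ⊥-elim (leaf≢centre e (sym o≡leaf))
    vertex-injective {suc e} {zero} leaf≡o = ⊥-elim (leaf≢centre e leaf≡o)
    vertex-injective {suc e} {suc f} leaf≡ = cong suc (leaf-injective leaf≡)

    iso : ∀ {T'} → (o ∈ T ⇔ zero ∈ T') → (∀ e → leaf e ∈ T ⇔ suc e ∈ T') → GraftIso G T K13 T'
    iso {T'} centre-T leaf-T = injective⇒GraftIso K13 T' noIsolated vertex vertex-injective (↔-id _) Joins-leaf inT
      where
      inT : ∀ x → x ∈ T' ⇔ vertex x ∈ T
      inT zero = ⇔-sym centre-T
      inT (suc e) = ⇔-sym (leaf-T e)

  module Triangle {a b c} (j₀ : Joins G e₀ a b) (j₁ : Joins G e₁ b c) (j₂ : Joins G e₂ a c) where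

    vertex : Fin 3 → Fin n
    vertex zero = a
    vertex (suc zero) = b
    vertex (suc (suc zero)) = c

    Joins-vertex : ∀ e → Joins G e (vertex (end₁ K3 e)) (vertex (end₂ K3 e))
    Joins-vertex zero = j₀
    Joins-vertex (suc zero) = j₁
    Joins-vertex (suc (suc zero)) = j₂

    b≢a : b ≢ a
    b≢a = Joins⇒≢ G (loopless e₀) j₀
    c≢b : c ≢ b
    c≢b = Joins⇒≢ G (loopless e₁) j₁
    c≢a : c ≢ a
    c≢a = Joins⇒≢ G (loopless e₂) j₂

    vertex-injective : ∀ {x y} → vertex x ≡ vertex y → x ≡ y
    vertex-injective {zero} {zero} _ = refl
    vertex-injective {zero} {suc zero} a≡b = ⊥-elim (b≢a (sym a≡b))
    vertex-injective {zero} {suc (suc zero)} a≡c = ⊥-elim (c≢a (sym a≡c))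
    vertex-injective {suc zero} {zero} b≡a = ⊥-elim (b≢a b≡a)
    vertex-injective {suc zero} {suc zero} _ = refl
    vertex-injective {suc zero} {suc (suc zero)} b≡c = ⊥-elim (c≢b (sym b≡c))
    vertex-injective {suc (suc zero)} {zero} c≡a = ⊥-elim (c≢a c≡a)
    vertex-injective {suc (suc zero)} {suc zero} c≡b = ⊥-elim (c≢b c≡b)
    vertex-injective {suc (suc zero)} {suc (suc zero)} _ = refl

    iso : (∀ v → v ∈ T) → GraftIso G T K3 S.⊤
    iso all∈T = injective⇒GraftIso K3 S.⊤ noIsolated vertex vertex-injective (↔-id _) Joins-vertex
                          (λ x → mk⇔ (λ _ → all∈T (vertex x)) (λ _ → ∈⊤))

  StarShaped : Set
  StarShaped = ∃ λ o → ∀ e → Incident G e o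

  TriangleShaped : Set
  TriangleShaped = ∃₂ λ a b → ∃ λ c → Joins G e₀ a b × Joins G e₁ b c × Joins G e₂ a c

  module _ (meets : ∀ {e f} → e ≢ f → Meets G e f) where

    -- e₁ and e₂ meet e₀ at different ends x and y, so they meet each other at a third vertex
    crossing : ∀ {x y c} → Joins G e₀ y x → Joins G e₁ x c → Incident G e₂ y → ¬ Incident G e₂ x →
               TriangleShaped
    crossing {x} {y} {c} j₀ j₁ i₂ e₂∌x with meets {e₁} {e₂} (λ ())
    ... | z , z∈e₁ , z∈e₂ with Incident-Joins G j₁ z∈e₁
    ...   | inj₁ refl = ⊥-elim (e₂∌x z∈e₂)
    ...   | inj₂ refl = y , x , c , j₀ , j₁ ,
      Incident⇒Joins G i₂ z∈e₂ λ { refl → simple (λ ()) (Joins-parallel G (Joins-sym G j₁) j₀) }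

    pairwise-meeting⇒star⊎triangle : StarShaped ⊎ TriangleShaped
    pairwise-meeting⇒star⊎triangle
      with incident? G e₁ (end₁ G e₀) ×-dec incident? G e₂ (end₁ G e₀)
         | incident? G e₁ (end₂ G e₀) ×-dec incident? G e₂ (end₂ G e₀)
    ... | yes (i₁ , i₂) | _ = inj₁ (end₁ G e₀ , λ { zero → inj₁ refl ; (suc zero) → i₁ ; (suc (suc zero)) → i₂ })
    ... | no _ | yes (i₁ , i₂) = inj₁ (end₂ G e₀ , λ { zero → inj₂ refl ; (suc zero) → i₁ ; (suc (suc zero)) → i₂ })
    ... | no ¬at₁ | no ¬at₂ with meets {e₀} {e₁} (λ ()) | meets {e₀} {e₂} (λ ())
    ...   | _ , inj₁ refl , i₁ | _ , inj₁ refl , i₂ = ⊥-elim (¬at₁ (i₁ , i₂))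
    ...   | _ , inj₂ refl , i₁ | _ , inj₂ refl , i₂ = ⊥-elim (¬at₂ (i₁ , i₂))
    ...   | _ , inj₁ refl , i₁ | _ , inj₂ refl , i₂ =
      inj₂ (crossing (Joins-sym G (Joins-ends G e₀)) (Joins-other-end G i₁) i₂ (¬at₁ ∘ (i₁ ,_)))
    ...   | _ , inj₂ refl , i₁ | _ , inj₁ refl , i₂ =
      inj₂ (crossing (Joins-ends G e₀) (Joins-other-end G i₁) i₂ (¬at₂ ∘ (i₁ ,_)))

another : Fin 3 → Fin 3
another zero = suc zero
another (suc _) = zero

another-≢ : ∀ e → e ≢ another e
another-≢ zero ()
another-≢ (suc _) ()

parity-pair : ∀ {e f : Fin 3} → e ≢ f → parity (⁅ e ⁆ ∪ ⁅ f ⁆) ≡ false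
parity-pair {zero} {zero} e≢f = ⊥-elim (e≢f refl)
parity-pair {zero} {suc zero} _ = refl
parity-pair {zero} {suc (suc zero)} _ = refl
parity-pair {suc zero} {zero} _ = refl
parity-pair {suc zero} {suc zero} e≢f = ⊥-elim (e≢f refl)
parity-pair {suc zero} {suc (suc zero)} _ = refl
parity-pair {suc (suc zero)} {zero} _ = refl
parity-pair {suc (suc zero)} {suc zero} _ = refl
parity-pair {suc (suc zero)} {suc (suc zero)} e≢f = ⊥-elim (e≢f refl)

parity-⁅⁆ : ∀ (e : Fin 3) → parity ⁅ e ⁆ ≡ true
parity-⁅⁆ zero = refl
parity-⁅⁆ (suc zero) = refl
parity-⁅⁆ (suc (suc zero)) = refl

module Even {n ends} {T : Subset n} (noIsolated : NoIsolated (Graph₃ n ends))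
  (even : ∀ F → Feasible (graftDM (Graph₃ n ends) T) F ⇔ (parity F ≡ false)) where

  private
    G : Graph
    G = Graph₃ n ends

  pair-feasible : ∀ {e f} → e ≢ f → Feasible (graftDM G T) (⁅ e ⁆ ∪ ⁅ f ⁆)
  pair-feasible e≢f = Equivalence.from (even _) (parity-pair e≢f)

  loopless : ∀ e → end₁ G e ≢ end₂ G e
  loopless e = forest⇒loopless (proj₁ (pair-feasible (another-≢ e))) ∈⁅x⁆∪⁅y⁆ˡ

  simple : ∀ {e f} → f ≢ e → ¬ Joins G f (end₁ G e) (end₂ G e)
  simple f≢e = forest⇒simple (proj₁ (pair-feasible f≢e)) ∈⁅x⁆∪⁅y⁆ʳ ∈⁅x⁆∪⁅y⁆ˡ f≢e

  all∈T : ∀ v → v ∈ T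
  all∈T v with noIsolated v
  ... | e , _ , j = untouched-vertex∈T (Equivalence.from (even S.⊥) refl) (⊥-elim ∘ ∉⊥) j (Joins⇒≢ G (loopless e) j)

  meets : ∀ {e f} → e ≢ f → Meets G e f
  meets {e} {f} e≢f with any? (λ v → incident? G e v ×-dec incident? G f v)
  ... | yes m = m
  ... | no ¬m = ⊥-elim (isolated-edge-infeasible (pair-feasible e≢f) all∈T ∈⁅x⁆∪⁅y⁆ˡ (loopless e) isolated)
    where
    isolated : ∀ {g} → g ∈ ⁅ e ⁆ ∪ ⁅ f ⁆ → g ≢ e → ¬ Meets G e g
    isolated g∈ g≢e with x∈p∪q⁻ ⁅ e ⁆ ⁅ f ⁆ g∈
    ... | inj₁ g∈⁅e⁆ = ⊥-elim (g≢e (x∈⁅y⁆⇒x≡y e g∈⁅e⁆))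
    ... | inj₂ g∈⁅f⁆ rewrite x∈⁅y⁆⇒x≡y f g∈⁅f⁆ = ¬m

  open Simple₃ {T = T} noIsolated loopless simple

  Δ₁⊎Δ₂ : GraftIso G T K3 S.⊤ ⊎ GraftIso G T K13 S.⊤
  Δ₁⊎Δ₂ with pairwise-meeting⇒star⊎triangle meets
  ... | inj₁ (o , at-o) = inj₂ (Star.iso o at-o (T⇔⊤ o) (λ e → T⇔⊤ (Star.leaf o at-o e)))
    where
    T⇔⊤ : ∀ v {x} → v ∈ T ⇔ x ∈ S.⊤ {4}
    T⇔⊤ v = mk⇔ (λ _ → ∈⊤) (λ _ → all∈T v)
  ... | inj₂ (_ , _ , _ , j₀ , j₁ , j₂) = inj₁ (Triangle.iso j₀ j₁ j₂ all∈T)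

module Odd {n ends} {T : Subset n} (noIsolated : NoIsolated (Graph₃ n ends))
  (odd : ∀ F → Feasible (graftDM (Graph₃ n ends) T) F ⇔ (parity F ≡ true)) where

  private
    G : Graph
    G = Graph₃ n ends

  ⁅⁆-feasible : ∀ e → Feasible (graftDM G T) ⁅ e ⁆
  ⁅⁆-feasible e = Equivalence.from (odd _) (parity-⁅⁆ e)

  loopless : ∀ e → end₁ G e ≢ end₂ G e
  loopless e = forest⇒loopless (proj₁ (⁅⁆-feasible e)) (x∈⁅x⁆ e)

  simple : ∀ {e f} → f ≢ e → ¬ Joins G f (end₁ G e) (end₂ G e)
  simple = forest⇒simple (proj₁ (Equivalence.from (odd S.⊤) refl)) ∈⊤ ∈⊤

  outside-T : ∃ λ v → v ∉ T
  outside-T = ¬∀⟶∃¬ n (_∈ T) (_∈? T) λ all∈T → case Equivalence.to (odd S.⊥) (⊥-feasible all∈T) of λ ()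

  o : Fin n
  o = proj₁ outside-T

  o∉T : o ∉ T
  o∉T = proj₂ outside-T

  untouched-by-⁅⁆ : ∀ {e v} → ¬ Incident G e v → ∀ {f} → f ∈ ⁅ e ⁆ → ¬ Incident G f v
  untouched-by-⁅⁆ {e} {v} e∌v f∈⁅e⁆ = e∌v ∘ subst (λ f → Incident G f v) (x∈⁅y⁆⇒x≡y e f∈⁅e⁆)

  -- an edge missing o would leave o isolated in a feasible forest, forcing o ∈ T
  at-o : ∀ e → Incident G e o
  at-o e with incident? G e o
  ... | yes i = i
  ... | no e∌o with noIsolated o
  ...   | f , _ , j = ⊥-elim (o∉T (untouched-vertex∈T (⁅⁆-feasible e) (untouched-by-⁅⁆ e∌o) j (Joins⇒≢ G (loopless f) j)))

  open Simple₃ {T = T} noIsolated loopless simple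
  open Star o at-o

  leaf∈T : ∀ e → leaf e ∈ T
  leaf∈T e = untouched-vertex∈T (⁅⁆-feasible (another e)) (untouched-by-⁅⁆ another∌leaf)
                                (Joins-sym G (Joins-leaf e)) (leaf≢centre e ∘ sym)
    where
    another∌leaf : ¬ Incident G (another e) (leaf e)
    another∌leaf i with Incident-Joins G (Joins-leaf (another e)) i
    ... | inj₁ leaf≡o = leaf≢centre e leaf≡o
    ... | inj₂ leaf≡ = another-≢ e (leaf-injective leaf≡)

  leaf∈leavesK13 : ∀ e → suc e ∈ leavesK13
  leaf∈leavesK13 zero = there here
  leaf∈leavesK13 (suc zero) = there (there here)
  leaf∈leavesK13 (suc (suc zero)) = there (there (there here))

  Δ₃ : GraftIso G T K13 leavesK13
  Δ₃ = iso (mk⇔ (⊥-elim ∘ o∉T) λ ()) (λ e → mk⇔ (λ _ → leaf∈leavesK13 e) (λ _ → leaf∈T e))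

parityFamily⇒IsDelta : ∀ {n ends T} → NoIsolated (Graph₃ n ends) →
                       ParityFamily (graftDM (Graph₃ n ends) T) → IsDelta (Graph₃ n ends) T
parityFamily⇒IsDelta noIsolated (false , even) = [ inj₁ , inj₂ ∘ inj₁ ] (Even.Δ₁⊎Δ₂ noIsolated even)
parityFamily⇒IsDelta noIsolated (true , odd) = inj₂ (inj₂ (Odd.Δ₃ noIsolated odd))

lemma3p5 : (G : Graph) (T : Subset (nV G)) → NoIsolated G →
           (∃ λ (X : Subset (nE G)) → twist (graftDM G T) X ≅ MK3) ⇔ IsDelta G T
lemma3p5 G T noIsolated = mk⇔ forward backward
  where
  forward : (∃ λ X → twist (graftDM G T) X ≅ MK3) → IsDelta G T
  forward (X , iso) =
    three-edges-elim (λ G → ∀ T → NoIsolated G → ParityFamily (graftDM G T) → IsDelta G T)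
                     (λ _ _ _ → parityFamily⇒IsDelta) G (proj₁ iso) T noIsolated (twist≅MK3⇒parityFamily iso)

  backward : IsDelta G T → ∃ λ X → twist (graftDM G T) X ≅ MK3
  backward (inj₁ iso) =
    parityFamily⇒twist≅MK3 (≅-parityFamily (graftIso⇒≅ iso) Δ₁-parityFamily) (proj₁ (proj₂ iso))
  backward (inj₂ (inj₁ iso)) =
    parityFamily⇒twist≅MK3 (≅-parityFamily (graftIso⇒≅ iso) Δ₂-parityFamily) (proj₁ (proj₂ iso))
  backward (inj₂ (inj₂ iso)) =
    parityFamily⇒twist≅MK3 (≅-parityFamily (graftIso⇒≅ iso) Δ₃-parityFamily) (proj₁ (proj₂ iso))
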